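{- Let $n\ge1$ and $\tau\in\mathfrak S_n$, and write $\tau=m_1a_1m_2a_2\cdots m_ka_k$ where $m_1,\dots,m_k$ are the left-to-right minima of $\tau$ (in order) and each $a_i$ is the (possibly empty) factor between $m_i$ and $m_{i+1}$ (or after $m_k$). Then $\tau\in\mathrm{Sort}_n(\mathfrak{s}_{1\underline{32}})$ if and only if the word $\mathrm{rev}(a_1)\mathrm{rev}(a_2)\cdots\mathrm{rev}(a_k)$ is decreasing.
   Context: A pattern is a permutation $\sigma$ in which some blocks of consecutive entries may be underlined; a sequence contains it if it has a subsequence order-isomorphic to $\sigma$ whose entries corresponding to a common underlined block are adjacent in the sequence. $\mathrm{rev}$ denotes reversal of a word. Pattern-avoiding stack map $\mathfrak{s}_\sigma$: process input $\tau_1,\dots,\tau_n$ in order; when $\tau_i$ is next, while the stack is nonempty and the sequence formed by placing $\tau_i$ on top of the stack, read top to bottom, contains $\sigma$ (underlined entries adjacent in the stack), pop the top entry to the output; then push $\tau_i$; at the end pop all remaining entries top to bottom to the output. West's stack-sorting map $s$ pushes each input entry after popping all smaller stack entries to the output, emptying the stack at the end. $\mathrm{Sort}_n(\mathfrak{s}_\sigma)=\{\tau\in\mathfrak S_n: s(\mathfrak{s}_\sigma(\tau))=12\cdots n\}$ (equivalently $\mathfrak{s}_\sigma(\tau)$ avoids $231$). -}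

module Defs where

open import Data.Bool using (Bool; true; false; if_then_else_; _∧_; _∨_)
open import Data.Nat using (ℕ; suc; _<ᵇ_; _>_)
open import Data.List using (List; []; _∷_; _++_; reverse; concat; map; upTo)
open import Data.Product using (_×_; _,_; proj₂)
open import Data.List.Relation.Unary.Linked using (Linked)

-- Words are lists of naturals; a stack is a list whose head is the TOP.

idPerm : ℕ → List ℕ
idPerm n = map suc (upTo n)

adjPair : ℕ → List ℕ → Bool
adjPair x []            = false
adjPair x (y ∷ [])      = false
adjPair x (y ∷ z ∷ zs)  = ((x <ᵇ z) ∧ (z <ᵇ y)) ∨ adjPair x (z ∷ zs)

-- contains132u w = true iff the word w contains the pattern 1(32 underlined):
-- entries w_p, w_q, w_{q+1} with p < q and w_p < w_{q+1} < w_q.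
contains132u : List ℕ → Bool
contains132u []       = false
contains132u (x ∷ xs) = adjPair x xs ∨ contains132u xs

-- Generic stack map: `cond t st` (st nonempty stack, top first) decides
-- whether the top of the stack is popped before pushing t.
-- Output is accumulated reversed.
popLoop : (ℕ → List ℕ → Bool) → ℕ → List ℕ → List ℕ → List ℕ × List ℕ
popLoop cond t []       out = (t ∷ [] , out)
popLoop cond t (s ∷ st) out =
  if cond t (s ∷ st) then popLoop cond t st (s ∷ out) else (t ∷ s ∷ st , out)

runStack : (ℕ → List ℕ → Bool) → List ℕ → List ℕ → List ℕ → List ℕ
runStack cond st out []       = reverse out ++ st
runStack cond st out (t ∷ ts) with popLoop cond t st out
... | (st' , out') = runStack cond st' out' ts

-- Pattern-avoiding stack map s_{1 \underline{32}}: pop while (t on top of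
-- the stack), read top to bottom, contains 1\underline{32}.
sigmaCond : ℕ → List ℕ → Bool
sigmaCond t st = contains132u (t ∷ st)

s132u : List ℕ → List ℕ
s132u τ = runStack sigmaCond [] [] τ

westCond : ℕ → List ℕ → Bool
westCond t []      = false
westCond t (s ∷ _) = s <ᵇ t

west : List ℕ → List ℕ
west τ = runStack westCond [] [] τ

InSort : ℕ → List ℕ → Set
InSort n τ = west (s132u τ) ≡ idPerm n
  where open import Relation.Binary.PropositionalEquality using (_≡_)

-- Decomposition τ = m₁ a₁ m₂ a₂ ⋯ m_k a_k by left-to-right minima:
-- returns the list of pairs (m_i , a_i).
ltrGo : ℕ → List ℕ → List ℕ → List (ℕ × List ℕ)
ltrGo m acc []       = (m , reverse acc) ∷ []
ltrGo m acc (y ∷ ys) =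
  if y <ᵇ m then (m , reverse acc) ∷ ltrGo y [] ys else ltrGo m (y ∷ acc) ys

ltrDecomp : List ℕ → List (ℕ × List ℕ)
ltrDecomp []       = []
ltrDecomp (x ∷ xs) = ltrGo x [] xs

revFactors : List ℕ → List ℕ
revFactors τ = concat (map (λ p → reverse (proj₂ p)) (ltrDecomp τ))

-- decreasing word (strictly; entries of a permutation are distinct)
Decreasing : List ℕ → Set
Decreasing = Linked _>_

{-# OPTIONS --safe #-}
module Submission where

-- Run s = s_{1\underline{32}} on τ = m₁a₁⋯mₖaₖ.  As long as rev(a₁)⋯rev(aᵢ) is
-- decreasing, the stack holds the part of aᵢ read so far (latest entry on top) above
-- mᵢ, mᵢ₋₁, …, m₁, and the output is rev(a₁)⋯rev(aᵢ₋₁): a new left-to-right minimum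
-- pops the whole current factor, and every other entry is pushed without popping.
-- Let t be the first entry that spoils the monotonicity.  If t is smaller than the
-- previous entry of its factor, then t comes to rest directly above some z > t, with
-- the current minimum m < t further down; otherwise t exceeds an earlier output entry
-- o and is pushed above m < o.  Either way s(τ) contains the pattern 231, which
-- West's map never sorts.  If no such t exists, s(τ) is the decreasing word
-- rev(a₁)⋯rev(aₖ) followed by the increasing word mₖ⋯m₁, which West's map sorts.

open import Data.Nat using (ℕ; _≤_)
open import Data.List using (List)
open import Data.List.Relation.Binary.Permutation.Propositional using (_↭_)
open import Function.Bundles using (_⇔_)

open import Defs
open import Data.Bool using (Bool; true; false; _∧_; _∨_; if_then_else_)
open import Data.Bool.Properties using (∨-zeroʳ)
open import Data.Empty using (⊥-elim)
open import Data.Nat using (suc; s≤s; _<_; _≥_; _>_; _<ᵇ_)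
open import Data.Nat.Properties
  using ( <ᵇ-reflects-<; _<?_; ≤-trans; <-trans; <⇒≤; <⇒≢; <⇒≱; ≤⇒≯; ≮⇒≥; ≤∧≢⇒<; <-asym
        ; ≤-totalOrder)
open import Data.List using ([]; _∷_; _++_; _ʳ++_; reverse; concat; map)
open import Data.List.Properties
  using (++-assoc; ++-identityʳ; ʳ++-defn; ʳ++-ʳ++; reverse-++; reverse-involutive)
open import Data.List.Membership.Propositional using (_∈_; find)
open import Data.List.Membership.Propositional.Properties using (∈-++⁻; ∈-++⁺ˡ; ∈-++⁺ʳ)
open import Data.List.Relation.Binary.Permutation.Propositional
  using (↭-sym; ↭-trans; ↭-reflexive; ↭⇒↭ₛ; module PermutationReasoning)
open import Data.List.Relation.Binary.Permutation.Propositional.Properties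
  using (shift; ++⁺ˡ; ∈-resp-↭; ¬x∷xs↭[])
import Data.List.Relation.Binary.Permutation.Setoid.Properties as Permₛ
open import Data.List.Relation.Binary.Pointwise using (Pointwise-≡⇒≡)
open import Data.List.Relation.Binary.Sublist.Propositional
  using (_⊆_; []; _∷_; _∷ʳ_; ⊆-refl; ⊆-reflexive; ⊆-trans; to∈; from∈)
import Data.List.Relation.Binary.Sublist.Propositional.Properties as Sublist
open import Data.List.Relation.Unary.All as All using (All; []; _∷_)
import Data.List.Relation.Unary.All.Properties as Allₚ
open import Data.List.Relation.Unary.AllPairs as AllPairs using (AllPairs; []; _∷_)
import Data.List.Relation.Unary.AllPairs.Properties as AllPairsₚ
open import Data.List.Relation.Unary.Any using (here; there)
import Data.List.Relation.Unary.Any.Properties as Anyₚ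
open import Data.List.Relation.Unary.Linked using (Linked; []; [-]; _∷_)
open import Data.List.Relation.Unary.Linked.Properties using (Linked⇒AllPairs; AllPairs⇒Linked)
open import Data.List.Relation.Unary.Sorted.TotalOrder.Properties using (↗↭↗⇒≋)
open import Data.List.Relation.Unary.Unique.Propositional using (Unique)
open import Data.Product using (_×_; _,_; proj₁; proj₂; ∃; ∃₂)
open import Data.Sum using (inj₁; inj₂)
open import Function using (_∘_; flip; id)
open import Function.Bundles using (mk⇔; Equivalence)
open import Relation.Nullary using (¬_; yes; no)
open import Relation.Nullary.Reflects using (ofʸ; ofⁿ; det)
open import Relation.Binary.PropositionalEquality
  using (_≡_; _≢_; refl; sym; trans; cong; cong₂; subst; subst₂; setoid; module ≡-Reasoning)

private
  variable
    a b c t m o x : ℕ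
    acc ms O xs ys zs : List ℕ
    R : ℕ → ℕ → Set
    P : ℕ → Set

reverse-ʳ++ : ∀ (xs ys : List ℕ) → reverse (xs ʳ++ ys) ≡ reverse ys ++ xs
reverse-ʳ++ xs ys = begin
  reverse (xs ʳ++ ys)                 ≡⟨ cong reverse (ʳ++-defn xs) ⟩
  reverse (reverse xs ++ ys)          ≡⟨ reverse-++ (reverse xs) ys ⟩
  reverse ys ++ reverse (reverse xs)  ≡⟨ cong (reverse ys ++_) (reverse-involutive xs) ⟩
  reverse ys ++ xs                    ∎
  where open ≡-Reasoning

All-ʳ++⁺ : All P xs → All P ys → All P (xs ʳ++ ys)
All-ʳ++⁺ []         pys = pys
All-ʳ++⁺ (px ∷ pxs) pys = All-ʳ++⁺ pxs (px ∷ pys)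

AllPairs-++⁻ : AllPairs R (xs ++ ys) →
  AllPairs R xs × AllPairs R ys × All (λ x → All (R x) ys) xs
AllPairs-++⁻ {xs = []}     rys         = [] , rys , []
AllPairs-++⁻ {xs = x ∷ xs} (rx ∷ rxys) =
  let rxs , rys , cross = AllPairs-++⁻ rxys
  in  Allₚ.++⁻ˡ xs rx ∷ rxs , rys , Allₚ.++⁻ʳ xs rx ∷ cross

AllPairs-insert : AllPairs R (xs ++ ys) → All (λ x → R x t) xs → All (R t) ys →
  AllPairs R (xs ++ t ∷ ys)
AllPairs-insert {xs = []}     rys         []           rtys = rtys ∷ rys
AllPairs-insert {xs = x ∷ xs} (rx ∷ rxys) (rxt ∷ rxst) rtys =
  Allₚ.++⁺ (Allₚ.++⁻ˡ xs rx) (rxt ∷ Allₚ.++⁻ʳ xs rx) ∷ AllPairs-insert rxys rxst rtys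

AllPairs-ʳ++⁺ : AllPairs (flip R) xs → AllPairs R ys → All (λ x → All (R x) ys) xs →
  AllPairs R (xs ʳ++ ys)
AllPairs-ʳ++⁺ []         rys []             = rys
AllPairs-ʳ++⁺ (rx ∷ rxs) rys (rxys ∷ cross) =
  AllPairs-ʳ++⁺ rxs (rxys ∷ rys) (All.zipWith (λ (rx′x , rx′ys) → rx′x ∷ rx′ys) (rx , cross))

AllPairs-resp-⊆ : xs ⊆ ys → AllPairs R ys → AllPairs R xs
AllPairs-resp-⊆ []             []          = []
AllPairs-resp-⊆ (_ ∷ʳ xs⊆ys)   (_ ∷ rys)   = AllPairs-resp-⊆ xs⊆ys rys
AllPairs-resp-⊆ (refl ∷ xs⊆ys) (ry ∷ rys) =
  Sublist.All-resp-⊆ xs⊆ys ry ∷ AllPairs-resp-⊆ xs⊆ys rys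

AllPairs-pair : a ∷ b ∷ [] ⊆ xs → AllPairs R xs → R a b
AllPairs-pair ab⊆xs rxs = All.head (AllPairs.head (AllPairs-resp-⊆ ab⊆xs rxs))

sorted-↭⇒≡ : AllPairs _≤_ xs → AllPairs _≤_ ys → xs ↭ ys → xs ≡ ys
sorted-↭⇒≡ xs↗ ys↗ xs↭ys = Pointwise-≡⇒≡
  (↗↭↗⇒≋ ≤-totalOrder (AllPairs⇒Linked xs↗) (AllPairs⇒Linked ys↗) (↭⇒↭ₛ xs↭ys))

Unique-resp-↭ : xs ↭ ys → Unique xs → Unique ys
Unique-resp-↭ xs↭ys = Permₛ.Unique-resp-↭ (setoid ℕ) (↭⇒↭ₛ xs↭ys)

Unique-shift : ∀ xs ys → Unique ((xs ++ ys) ++ t ∷ zs) → Unique ((xs ++ t ∷ ys) ++ zs)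
Unique-shift {t} {zs} xs ys = Unique-resp-↭ (begin
  (xs ++ ys) ++ t ∷ zs  ≡⟨ ++-assoc xs ys (t ∷ zs) ⟩
  xs ++ ys ++ t ∷ zs    ↭⟨ ++⁺ˡ xs (shift t ys zs) ⟩
  xs ++ t ∷ ys ++ zs    ≡⟨ ++-assoc xs (t ∷ ys) zs ⟨
  (xs ++ t ∷ ys) ++ zs  ∎)
  where open PermutationReasoning

Unique-++-∷⇒∉ : Unique (xs ++ t ∷ ys) → All (_≢ t) xs
Unique-++-∷⇒∉ unique = All.map All.head (proj₂ (proj₂ (AllPairs-++⁻ unique)))

<ᵇ-true : m < t → (m <ᵇ t) ≡ true
<ᵇ-true {m} {t} m<t = det (<ᵇ-reflects-< m t) (ofʸ m<t)

<ᵇ-false : t ≤ m → (m <ᵇ t) ≡ false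
<ᵇ-false {t} {m} t≤m = det (<ᵇ-reflects-< m t) (ofⁿ (≤⇒≯ t≤m))

-- Stack maps

Condition : Set
Condition = ℕ → List ℕ → Bool

snapshot : List ℕ × List ℕ → List ℕ
snapshot state = proj₂ state ʳ++ proj₁ state

stack⊆snapshot : ∀ state → proj₁ state ⊆ snapshot state
stack⊆snapshot (st , out) = subst (st ⊆_) (sym (ʳ++-defn out)) (Sublist.++⁺ˡ (reverse out) ⊆-refl)

module _ (cond : Condition) where

  popLoop-push : ∀ {st out} → cond t st ≡ false → popLoop cond t st out ≡ (t ∷ st , out)
  popLoop-push {st = []}                _    = refl
  popLoop-push {t} {st = s ∷ st} {out} stop =
    cong (λ b → if b then popLoop cond t st (s ∷ out) else (t ∷ s ∷ st , out)) stop

  popLoop-pop : ∀ {s st out} → cond t (s ∷ st) ≡ true →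
    popLoop cond t (s ∷ st) out ≡ popLoop cond t st (s ∷ out)
  popLoop-pop {t} {s} {st} {out} go =
    cong (λ b → if b then popLoop cond t st (s ∷ out) else (t ∷ s ∷ st , out)) go

  popLoop-pops-prefix : ∀ t st out → ∃₂ λ popped rest →
    st ≡ popped ++ rest × popLoop cond t st out ≡ (t ∷ rest , popped ʳ++ out)
  popLoop-pops-prefix t []       out = [] , [] , refl , refl
  popLoop-pops-prefix t (s ∷ st) out with cond t (s ∷ st)
  ... | false = [] , s ∷ st , refl , refl
  ... | true  =
    let popped , rest , st≡ , step≡ = popLoop-pops-prefix t st (s ∷ out)
    in  s ∷ popped , rest , cong (s ∷_) st≡ , step≡

  runStack-via : ∀ st out t ys {st′ out′} → popLoop cond t st out ≡ (st′ , out′) →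
    runStack cond st out (t ∷ ys) ≡ runStack cond st′ out′ ys
  runStack-via st out t ys step≡ rewrite step≡ = refl

  runStack-snapshot : ∀ ys st out → snapshot (st , out) ⊆ runStack cond st out ys
  runStack-snapshot []       st out = ⊆-reflexive (ʳ++-defn out)
  runStack-snapshot (t ∷ ys) st out with popLoop-pops-prefix t st out
  ... | popped , rest , refl , step≡ = begin
    out ʳ++ popped ++ rest
      ⊆⟨ Sublist.ʳ++⁺ (⊆-refl {x = out}) (Sublist.++⁺ (⊆-refl {x = popped}) (t ∷ʳ ⊆-refl)) ⟩
    out ʳ++ popped ++ t ∷ rest
      ≡⟨ ʳ++-ʳ++ popped ⟨
    (popped ʳ++ out) ʳ++ t ∷ rest
      ⊆⟨ runStack-snapshot ys (t ∷ rest) (popped ʳ++ out) ⟩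
    runStack cond (t ∷ rest) (popped ʳ++ out) ys
      ≡⟨ runStack-via (popped ++ rest) out t ys step≡ ⟨
    runStack cond (popped ++ rest) out (t ∷ ys)
      ∎
    where open Sublist.⊆-Reasoning

  runStack-output : ∀ ys st out → ∃ λ later →
    runStack cond st out ys ≡ out ʳ++ later × later ↭ st ++ ys
  runStack-output []       st out = st , sym (ʳ++-defn out) , ↭-reflexive (sym (++-identityʳ st))
  runStack-output (t ∷ ys) st out with popLoop-pops-prefix t st out
  ... | popped , rest , refl , step≡ =
    let later , run≡ , later↭ = runStack-output ys (t ∷ rest) (popped ʳ++ out)
    in  popped ++ later
      , trans (runStack-via (popped ++ rest) out t ys step≡) (trans run≡ (ʳ++-ʳ++ popped))
      , (begin
          popped ++ later             ↭⟨ ++⁺ˡ popped later↭ ⟩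
          popped ++ t ∷ rest ++ ys    ↭⟨ ++⁺ˡ popped (shift t rest ys) ⟨
          popped ++ rest ++ t ∷ ys    ≡⟨ ++-assoc popped rest (t ∷ ys) ⟨
          (popped ++ rest) ++ t ∷ ys  ∎)
    where open PermutationReasoning

  runStack-↭ : ∀ ys → runStack cond [] [] ys ↭ ys
  runStack-↭ ys = let _ , run≡ , later↭ = runStack-output ys [] [] in
    subst (_↭ ys) (sym run≡) later↭

  runStack-output-before-pending : ∀ ys st out → x ∈ out → a ∈ st ++ ys →
    AllPairs R (runStack cond st out ys) → R x a
  runStack-output-before-pending ys st out x∈out a∈later related =
    let later , run≡ , later↭ = runStack-output ys st out
        _ , _ , cross = AllPairs-++⁻ (subst (AllPairs _) (trans run≡ (ʳ++-defn out)) related)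
    in  All.lookup (All.lookup cross (Anyₚ.reverse⁺ x∈out)) (∈-resp-↭ (↭-sym later↭) a∈later)

-- West's stack-sorting map

sorted-split : ∀ t {st} → AllPairs _≤_ st → ∃₂ λ small big →
  st ≡ small ++ big × All (_< t) small × All (t ≤_) big
sorted-split t []                    = [] , [] , refl , [] , []
sorted-split t {s ∷ st} (s≤st ∷ st↗) with s <? t
... | yes s<t =
  let small , big , st≡ , small<t , t≤big = sorted-split t st↗
  in  s ∷ small , big , cong (s ∷_) st≡ , s<t ∷ small<t , t≤big
... | no s≮t =
  let t≤s = ≮⇒≥ s≮t
  in  [] , s ∷ st , refl , [] , t≤s ∷ All.map (≤-trans t≤s) s≤st

popLoop-west : ∀ small {big out} → All (_< t) small → All (t ≤_) big →
  popLoop westCond t (small ++ big) out ≡ (t ∷ big , small ʳ++ out)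
popLoop-west []          {[]}    _ _         = refl
popLoop-west []          {_ ∷ _} _ (t≤b ∷ _) = popLoop-push westCond (<ᵇ-false t≤b)
popLoop-west (s ∷ small) (s<t ∷ small<t) t≤big =
  trans (popLoop-pop westCond {st = small ++ _} (<ᵇ-true s<t)) (popLoop-west small small<t t≤big)

module _ (a<b : a < b) (b<c : b < c) where

  west-unsorted-from-stack : ∀ ys {st} out → AllPairs _≤_ st → b ∈ st → c ∷ a ∷ [] ⊆ ys →
    ¬ AllPairs _≤_ (runStack westCond st out ys)
  west-unsorted-from-stack (t ∷ ys) out st↗ b∈st ca⊆ with sorted-split t st↗
  ... | small , big , refl , small<t , t≤big
    rewrite popLoop-west small {out = out} small<t t≤big
    with ∈-++⁻ small b∈st | ca⊆
  ... | inj₁ b∈small | _ = <⇒≱ a<b ∘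
          runStack-output-before-pending westCond ys (t ∷ big) (small ʳ++ out)
            b∈popped (∈-++⁺ʳ (t ∷ big) (to∈ (Sublist.∷⁻ ca⊆)))
    where
    b∈popped : b ∈ small ʳ++ out
    b∈popped = subst (b ∈_) (sym (ʳ++-defn small)) (∈-++⁺ˡ (Anyₚ.reverse⁺ b∈small))
  ... | inj₂ b∈big | refl ∷ _   = ⊥-elim (<⇒≱ b<c (All.lookup t≤big b∈big))
  ... | inj₂ b∈big | _ ∷ʳ ca⊆ys =
    west-unsorted-from-stack ys (small ʳ++ out) (t≤big ∷ proj₁ (proj₂ (AllPairs-++⁻ st↗)))
      (there b∈big) ca⊆ys

  west-unsorted-from-input : ∀ ys {st} out → AllPairs _≤_ st → b ∷ c ∷ a ∷ [] ⊆ ys →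
    ¬ AllPairs _≤_ (runStack westCond st out ys)
  west-unsorted-from-input (t ∷ ys) out st↗ bca⊆ with sorted-split t st↗
  ... | small , big , refl , small<t , t≤big
    rewrite popLoop-west small {out = out} small<t t≤big with bca⊆
  ... | refl ∷ ca⊆ys =
    west-unsorted-from-stack ys (small ʳ++ out) (t≤big ∷ proj₁ (proj₂ (AllPairs-++⁻ st↗)))
      (here refl) ca⊆ys
  ... | _ ∷ʳ bca⊆ys  =
    west-unsorted-from-input ys (small ʳ++ out) (t≤big ∷ proj₁ (proj₂ (AllPairs-++⁻ st↗)))
      bca⊆ys

  west-unsorted-231 : ∀ {w} → b ∷ c ∷ a ∷ [] ⊆ w → ¬ AllPairs _≤_ (west w)
  west-unsorted-231 = west-unsorted-from-input _ [] []

  west-unsorted-after-step : ∀ cond t st out ys →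
    b ∷ c ∷ a ∷ [] ⊆ snapshot (popLoop cond t st out) →
    ¬ AllPairs _≤_ (west (runStack cond st out (t ∷ ys)))
  west-unsorted-after-step cond t st out ys bca⊆ = west-unsorted-231 (⊆-trans bca⊆
    (runStack-snapshot cond ys (proj₁ (popLoop cond t st out)) (proj₂ (popLoop cond t st out))))

west-sorts-ascending : ∀ M st out → AllPairs _≤_ M → All (λ o → All (o ≤_) M) out →
  AllPairs _≤_ (reverse out ++ st) → AllPairs _≤_ (runStack westCond st out M)
west-sorts-ascending []      st out _              _     sorted = sorted
west-sorts-ascending (m ∷ M) st out (m≤M ∷ M↗) out≤mM sorted
  with sorted-split m (proj₁ (proj₂ (AllPairs-++⁻ {xs = reverse out} sorted)))
... | small , big , refl , small<m , m≤big
  rewrite popLoop-west small {out = out} small<m m≤big =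
  west-sorts-ascending M (m ∷ big) (small ʳ++ out) M↗ out′≤M sorted′
  where
  out′≤M : All (λ o → All (o ≤_) M) (small ʳ++ out)
  out′≤M = All-ʳ++⁺ (All.map (λ s<m → All.map (≤-trans (<⇒≤ s<m)) m≤M) small<m)
                    (All.map All.tail out≤mM)
  before-m≤m : All (_≤ m) (reverse out ++ small)
  before-m≤m = Allₚ.++⁺ (All-ʳ++⁺ (All.map All.head out≤mM) []) (All.map <⇒≤ small<m)
  sorted′ : AllPairs _≤_ (reverse (small ʳ++ out) ++ m ∷ big)
  sorted′ = subst (AllPairs _≤_) (sym (cong (_++ m ∷ big) (reverse-ʳ++ small out)))
    (AllPairs-insert (subst (AllPairs _≤_) (sym (++-assoc (reverse out) small big)) sorted)
      before-m≤m m≤big)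

runStack-west-push : ∀ D {st out} M → AllPairs _≤_ (D ʳ++ st) →
  runStack westCond st out (D ++ M) ≡ runStack westCond (D ʳ++ st) out M
runStack-west-push []      M _      = refl
runStack-west-push (d ∷ D) {st} {out} M sorted =
  trans (runStack-via westCond st out d (D ++ M) (popLoop-west [] [] d≤st))
        (runStack-west-push D M sorted)
  where
  d≤st : All (d ≤_) st
  d≤st = AllPairs.head (proj₁ (proj₂ (AllPairs-++⁻ {xs = reverse D}
           (subst (AllPairs _≤_) (ʳ++-defn D) sorted))))

west-sorts-decreasing++increasing : ∀ D M → AllPairs _≥_ D → AllPairs _≤_ M →
  AllPairs _≤_ (west (D ++ M))
west-sorts-decreasing++increasing D M D↘ M↗ =
  subst (AllPairs _≤_) (sym (runStack-west-push D M reverse-D↗))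
    (west-sorts-ascending M (D ʳ++ []) [] M↗ [] reverse-D↗)
  where
  reverse-D↗ : AllPairs _≤_ (D ʳ++ [])
  reverse-D↗ = AllPairs-ʳ++⁺ D↘ [] (All.tabulate (λ _ → []))

-- The pattern 1(32) with 32 adjacent

no-value-between : ∀ d z y → ¬ (d < z × z < y) → ((d <ᵇ z) ∧ (z <ᵇ y)) ≡ false
no-value-between d z y ¬between
  with d <ᵇ z | <ᵇ-reflects-< d z | z <ᵇ y | <ᵇ-reflects-< z y
... | false | _       | _     | _       = refl
... | true  | _       | false | _       = refl
... | true  | ofʸ d<z | true  | ofʸ z<y = ⊥-elim (¬between (d<z , z<y))

adjPair-ascending : ∀ d {w} → Linked _≤_ w → adjPair d w ≡ false
adjPair-ascending d []                    = refl
adjPair-ascending d [-]                   = refl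
adjPair-ascending d {y ∷ z ∷ _} (y≤z ∷ w↗) =
  cong₂ _∨_ (no-value-between d z y (λ (_ , z<y) → <⇒≱ z<y y≤z)) (adjPair-ascending d w↗)

adjPair-∷ : ∀ d y w → y ≤ d → adjPair d w ≡ false → adjPair d (y ∷ w) ≡ false
adjPair-∷ d y []      _   _    = refl
adjPair-∷ d y (z ∷ _) y≤d rest =
  cong₂ _∨_ (no-value-between d z y (λ (d<z , z<y) → <⇒≱ (<-trans d<z z<y) y≤d)) rest

adjPair-∷-∷ : ∀ d y z w → z ≤ d → adjPair d (z ∷ w) ≡ false → adjPair d (y ∷ z ∷ w) ≡ false
adjPair-∷-∷ d y z w z≤d rest = cong₂ _∨_ (no-value-between d z y (λ (d<z , _) → <⇒≱ d<z z≤d)) rest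

adjPair-below-++-ascending : ∀ d {D A} → All (_≤ d) D → Linked _≤_ A → adjPair d (D ++ A) ≡ false
adjPair-below-++-ascending d []                        A↗ = adjPair-ascending d A↗
adjPair-below-++-ascending d {y ∷ D} {A} (y≤d ∷ D≤d) A↗ =
  adjPair-∷ d y (D ++ A) y≤d (adjPair-below-++-ascending d D≤d A↗)

adjPair-descent : ∀ {d z y w} → d < z → z < y → adjPair d (y ∷ z ∷ w) ≡ true
adjPair-descent d<z z<y rewrite <ᵇ-true d<z | <ᵇ-true z<y = refl

adjPair-descent-onto : ∀ {d m x acc ms} → d < m → All (m <_) (x ∷ acc) →
  adjPair d (x ∷ acc ++ m ∷ ms) ≡ true
adjPair-descent-onto {acc = []}    {ms} d<m (m<x ∷ [])   = adjPair-descent {w = ms} d<m m<x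
adjPair-descent-onto {acc = _ ∷ _} {ms} d<m (_ ∷ m<acc) =
  trans (cong (_ ∨_) (adjPair-descent-onto {ms = ms} d<m m<acc)) (∨-zeroʳ _)

avoids-∷ : ∀ x w → adjPair x w ≡ false → contains132u w ≡ false → contains132u (x ∷ w) ≡ false
avoids-∷ _ _ = cong₂ _∨_

ascending-avoids-132u : ∀ {A} → Linked _≤_ A → contains132u A ≡ false
ascending-avoids-132u []               = refl
ascending-avoids-132u [-]              = refl
ascending-avoids-132u {x ∷ w} (_ ∷ w↗) =
  avoids-∷ x w (adjPair-ascending x w↗) (ascending-avoids-132u w↗)

valley-avoids-132u : ∀ {D A} → AllPairs _≥_ D → Linked _≤_ A → contains132u (D ++ A) ≡ false
valley-avoids-132u []                       A↗ = ascending-avoids-132u A↗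
valley-avoids-132u {d ∷ D} {A} (D≤d ∷ D↘) A↗ =
  avoids-∷ d (D ++ A) (adjPair-below-++-ascending d D≤d A↗) (valley-avoids-132u D↘ A↗)

-- The map s_{1\underline{32}}

popLoop-σ-valley : ∀ {D A out} → AllPairs _≥_ (t ∷ D) → Linked _≤_ A →
  popLoop sigmaCond t (D ++ A) out ≡ (t ∷ D ++ A , out)
popLoop-σ-valley tD↘ A↗ = popLoop-push sigmaCond (valley-avoids-132u tD↘ A↗)

popLoop-σ-new-minimum : ∀ {out} → t < m → All (m <_) acc → Linked _≤_ (m ∷ ms) →
  popLoop sigmaCond t (acc ++ m ∷ ms) out ≡ (t ∷ m ∷ ms , acc ʳ++ out)
popLoop-σ-new-minimum {acc = []} _ [] m∷ms↗ = popLoop-σ-valley {D = []} ([] ∷ []) m∷ms↗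
popLoop-σ-new-minimum {m = m} {x ∷ acc} {ms} t<m m<x∷acc m∷ms↗ =
  trans (popLoop-pop sigmaCond {st = acc ++ m ∷ ms}
          (cong (_∨ _) (adjPair-descent-onto t<m m<x∷acc)))
        (popLoop-σ-new-minimum t<m (All.tail m<x∷acc) m∷ms↗)

popLoop-σ-blocked : ∀ {out} → m ≤ t → t < x → AllPairs _>_ (x ∷ acc) → Linked _≤_ (m ∷ ms) →
  ∃ λ z → t < z × t ∷ z ∷ m ∷ [] ⊆ proj₁ (popLoop sigmaCond t (x ∷ acc ++ m ∷ ms) out)
popLoop-σ-blocked {m} {t} {x} {[]} {ms} {out} m≤t t<x _ m∷ms↗ =
  x , t<x , subst (λ state → _ ⊆ proj₁ state)
              (sym (popLoop-push sigmaCond {st = x ∷ m ∷ ms} {out} stop))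
              (refl ∷ refl ∷ from∈ (here refl))
  where
  stop : contains132u (t ∷ x ∷ m ∷ ms) ≡ false
  stop = avoids-∷ t (x ∷ m ∷ ms) (adjPair-∷-∷ t x m ms m≤t (adjPair-ascending t m∷ms↗))
                   (valley-avoids-132u {D = x ∷ []} ([] ∷ []) m∷ms↗)
popLoop-σ-blocked {m} {t} {x} {y ∷ acc} {ms} {out} m≤t t<x x∷y∷acc↘ m∷ms↗ with t <? y
... | yes t<y =
  subst (λ state → ∃ λ z → t < z × t ∷ z ∷ m ∷ [] ⊆ proj₁ state)
    (sym (popLoop-pop sigmaCond {s = x} {y ∷ acc ++ m ∷ ms} {out} pop))
    (popLoop-σ-blocked m≤t t<y (AllPairs.tail x∷y∷acc↘) m∷ms↗)
  where
  pop : sigmaCond t (x ∷ y ∷ acc ++ m ∷ ms) ≡ true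
  pop = cong (_∨ contains132u (x ∷ y ∷ acc ++ m ∷ ms))
          (adjPair-descent {w = acc ++ m ∷ ms} t<y (All.head (AllPairs.head x∷y∷acc↘)))
... | no t≮y =
  x , t<x , subst (λ state → _ ⊆ proj₁ state)
              (sym (popLoop-push sigmaCond {st = x ∷ y ∷ acc ++ m ∷ ms} {out} stop))
              (refl ∷ refl ∷ from∈ (there (∈-++⁺ʳ acc (here refl))))
  where
  y≤t : y ≤ t
  y≤t = ≮⇒≥ t≮y
  y∷acc≤t : All (_≤ t) (y ∷ acc)
  y∷acc≤t = y≤t ∷ All.map (λ z<y → ≤-trans (<⇒≤ z<y) y≤t) (AllPairs.head (AllPairs.tail x∷y∷acc↘))
  stop : contains132u (t ∷ x ∷ y ∷ acc ++ m ∷ ms) ≡ false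
  stop = avoids-∷ t (x ∷ y ∷ acc ++ m ∷ ms)
    (adjPair-∷-∷ t x y (acc ++ m ∷ ms) y≤t (adjPair-below-++-ascending t y∷acc≤t m∷ms↗))
    (valley-avoids-132u (AllPairs.map <⇒≤ x∷y∷acc↘) m∷ms↗)

-- The word revFactors read from inside a factor: m is the current left-to-right
-- minimum and acc the part of its factor read so far, reversed.
factorsFrom : ℕ → List ℕ → List ℕ → List ℕ
factorsFrom m acc ys = concat (map (λ p → reverse (proj₂ p)) (ltrGo m acc ys))

factorsFrom-[] : ∀ m acc → factorsFrom m acc [] ≡ acc
factorsFrom-[] m acc = trans (++-identityʳ (reverse (reverse acc))) (reverse-involutive acc)

factorsFrom-new-minimum : ∀ acc ys → t < m → factorsFrom m acc (t ∷ ys) ≡ acc ++ factorsFrom t [] ys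
factorsFrom-new-minimum {t} acc ys t<m rewrite <ᵇ-true t<m =
  cong (_++ factorsFrom t [] ys) (reverse-involutive acc)

factorsFrom-extend : ∀ acc ys → m ≤ t → factorsFrom m acc (t ∷ ys) ≡ factorsFrom m (t ∷ acc) ys
factorsFrom-extend acc ys m≤t rewrite <ᵇ-false m≤t = refl

acc⊆factorsFrom : ∀ ys m acc → acc ⊆ factorsFrom m acc ys
acc⊆factorsFrom []       m acc = ⊆-reflexive (sym (factorsFrom-[] m acc))
acc⊆factorsFrom (t ∷ ys) m acc with t <? m
... | yes t<m = subst (acc ⊆_) (sym (factorsFrom-new-minimum acc ys t<m)) (Sublist.++⁺ʳ _ ⊆-refl)
... | no  t≮m = subst (acc ⊆_) (sym (factorsFrom-extend acc ys (≮⇒≥ t≮m)))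
                  (⊆-trans (t ∷ʳ ⊆-refl) (acc⊆factorsFrom ys m (t ∷ acc)))

-- The state of s_{1\underline{32}} inside the factor of the left-to-right minimum m:
-- the stack is acc ++ m ∷ ms, where acc is the part of the factor read so far (latest
-- entry first) and ms are the earlier minima, and the output is O.
record Invariant (m : ℕ) (acc ms O : List ℕ) : Set where
  field
    decreasing : AllPairs _>_ (O ++ acc)
    acc-above  : All (m <_) acc
    out-above  : All (m <_) O
    minima↗    : Linked _≤_ (m ∷ ms)

  acc-decreasing : AllPairs _>_ acc
  acc-decreasing = proj₁ (proj₂ (AllPairs-++⁻ {xs = O} decreasing))

open Invariant

invariant-new-minimum : Invariant m acc ms O → t < m → Invariant t [] (m ∷ ms) (O ++ acc)
invariant-new-minimum {acc = acc} {O = O} inv t<m = record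
  { decreasing = subst (AllPairs _>_) (sym (++-identityʳ (O ++ acc))) (decreasing inv)
  ; acc-above  = []
  ; out-above  = Allₚ.++⁺ (All.map (<-trans t<m) (out-above inv))
                          (All.map (<-trans t<m) (acc-above inv))
  ; minima↗    = <⇒≤ t<m ∷ minima↗ inv
  }

invariant-extend : Invariant m acc ms O → m < t → All (_< t) acc → All (t <_) O →
  Invariant m (t ∷ acc) ms O
invariant-extend inv m<t acc<t t<O = record
  { decreasing = AllPairs-insert (decreasing inv) t<O acc<t
  ; acc-above  = m<t ∷ acc-above inv
  ; out-above  = out-above inv
  ; minima↗    = minima↗ inv
  }

popLoop-σ-extend : ∀ {out} → Invariant m acc ms O → All (_< t) acc →
  popLoop sigmaCond t (acc ++ m ∷ ms) out ≡ (t ∷ acc ++ m ∷ ms , out)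
popLoop-σ-extend inv acc<t =
  popLoop-σ-valley (All.map <⇒≤ acc<t ∷ AllPairs.map <⇒≤ (acc-decreasing inv)) (minima↗ inv)

runStack-σ-new-minimum : ∀ ys → Invariant m acc ms O → t < m →
  runStack sigmaCond (acc ++ m ∷ ms) (reverse O) (t ∷ ys)
    ≡ runStack sigmaCond (t ∷ m ∷ ms) (reverse (O ++ acc)) ys
runStack-σ-new-minimum {m} {acc} {ms} {O} {t} ys inv t<m =
  trans (runStack-via sigmaCond (acc ++ m ∷ ms) (reverse O) t ys
           (popLoop-σ-new-minimum t<m (acc-above inv) (minima↗ inv)))
        (cong (λ out → runStack sigmaCond (t ∷ m ∷ ms) out ys)
           (trans (ʳ++-defn acc) (sym (reverse-++ O acc))))

unsorted-descent-in-factor : ∀ ys → Invariant m (x ∷ acc) ms O → m < t → t < x →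
  ¬ AllPairs _≤_ (west (runStack sigmaCond (x ∷ acc ++ m ∷ ms) (reverse O) (t ∷ ys)))
unsorted-descent-in-factor {m} {x} {acc} {ms} {O} {t} ys inv m<t t<x
  with popLoop-σ-blocked {out = reverse O} (<⇒≤ m<t) t<x (acc-decreasing inv) (minima↗ inv)
... | z , t<z , tzm⊆stack =
  west-unsorted-after-step m<t t<z sigmaCond t (x ∷ acc ++ m ∷ ms) (reverse O) ys
    (⊆-trans tzm⊆stack (stack⊆snapshot (popLoop sigmaCond t (x ∷ acc ++ m ∷ ms) (reverse O))))

undecreasing-descent-in-factor : ∀ ys → m < t → t < x →
  ¬ AllPairs _>_ (O ++ factorsFrom m (x ∷ acc) (t ∷ ys))
undecreasing-descent-in-factor {m} {t} {x} {O} {acc} ys m<t t<x decr =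
  <-asym t<x (AllPairs-pair tx⊆
    (subst (λ w → AllPairs _>_ (O ++ w)) (factorsFrom-extend (x ∷ acc) ys (<⇒≤ m<t)) decr))
  where
  tx⊆ : t ∷ x ∷ [] ⊆ O ++ factorsFrom m (t ∷ x ∷ acc) ys
  tx⊆ = Sublist.++⁺ˡ O (⊆-trans (Sublist.++⁺ʳ acc ⊆-refl) (acc⊆factorsFrom ys m (t ∷ x ∷ acc)))

unsorted-exceeds-earlier : ∀ ys → Invariant m acc ms O → All (_< t) acc → o ∈ O → o < t →
  ¬ AllPairs _≤_ (west (runStack sigmaCond (acc ++ m ∷ ms) (reverse O) (t ∷ ys)))
unsorted-exceeds-earlier {m} {acc} {ms} {O} {t} {o} ys inv acc<t o∈O o<t =
  west-unsorted-after-step (All.lookup (out-above inv) o∈O) o<t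
    sigmaCond t (acc ++ m ∷ ms) (reverse O) ys
    (subst (λ state → o ∷ t ∷ m ∷ [] ⊆ snapshot state)
      (sym (popLoop-σ-extend {out = reverse O} inv acc<t))
      (subst (o ∷ t ∷ m ∷ [] ⊆_)
        (sym (trans (ʳ++-defn (reverse O)) (cong (_++ t ∷ acc ++ m ∷ ms) (reverse-involutive O))))
        (Sublist.++⁺ (from∈ o∈O) (refl ∷ Sublist.++⁺ˡ acc (from∈ (here refl))))))

undecreasing-exceeds-earlier : ∀ ys → m < t → o ∈ O → o < t →
  ¬ AllPairs _>_ (O ++ factorsFrom m acc (t ∷ ys))
undecreasing-exceeds-earlier {m} {t} {o} {O} {acc} ys m<t o∈O o<t decr =
  <-asym o<t (AllPairs-pair ot⊆
    (subst (λ w → AllPairs _>_ (O ++ w)) (factorsFrom-extend acc ys (<⇒≤ m<t)) decr))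
  where
  ot⊆ : o ∷ t ∷ [] ⊆ O ++ factorsFrom m (t ∷ acc) ys
  ot⊆ = Sublist.++⁺ (from∈ o∈O) (⊆-trans (from∈ (here refl)) (acc⊆factorsFrom ys m (t ∷ acc)))

data Arrival (t m : ℕ) : List ℕ → List ℕ → Set where
  new-minimum       : t < m → Arrival t m acc O
  descent-in-factor : m < t → t < x → Arrival t m (x ∷ acc) O
  exceeds-earlier   : m < t → All (_< t) acc → o ∈ O → o < t → Arrival t m acc O
  extends-factor    : m < t → All (_< t) acc → All (t <_) O → Arrival t m acc O

arrival-above-factor : ∀ O → m < t → All (_< t) acc → All (_≢ t) O → Arrival t m acc O
arrival-above-factor {t = t} O m<t acc<t O≢t with All.all? (t <?_) O
... | yes t<O = extends-factor m<t acc<t t<O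
... | no  t≮O =
  let o , o∈O , t≮o = find (Allₚ.¬All⇒Any¬ (t <?_) O t≮O)
  in  exceeds-earlier m<t acc<t o∈O (≤∧≢⇒< (≮⇒≥ t≮o) (All.lookup O≢t o∈O))

arrival-above-minimum : ∀ O → m < t → AllPairs _>_ acc → All (_≢ t) acc → All (_≢ t) O →
  Arrival t m acc O
arrival-above-minimum O m<t []            []        O≢t = arrival-above-factor O m<t [] O≢t
arrival-above-minimum {t = t} {acc = x ∷ _} O m<t (x>acc ∷ _) (x≢t ∷ _) O≢t with t <? x
... | yes t<x = descent-in-factor m<t t<x
... | no  t≮x = arrival-above-factor O m<t (x<t ∷ All.map (λ y<x → <-trans y<x x<t) x>acc) O≢t
  where
  x<t : x < t
  x<t = ≤∧≢⇒< (≮⇒≥ t≮x) x≢t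

arrival : Invariant m acc ms O → All (_≢ t) (O ++ acc ++ m ∷ ms) → Arrival t m acc O
arrival {m} {acc} {ms} {O} {t} inv fresh with t <? m
... | yes t<m = new-minimum t<m
... | no  t≮m =
  arrival-above-minimum O (≤∧≢⇒< (≮⇒≥ t≮m) (All.head (Allₚ.++⁻ʳ acc acc++m∷ms≢t)))
    (acc-decreasing inv) (Allₚ.++⁻ˡ acc acc++m∷ms≢t) (Allₚ.++⁻ˡ O fresh)
  where
  acc++m∷ms≢t : All (_≢ t) (acc ++ m ∷ ms)
  acc++m∷ms≢t = Allₚ.++⁻ʳ O fresh

sorted-at-end : Invariant m acc ms O → AllPairs _≤_ (west (reverse (reverse O) ++ acc ++ m ∷ ms))
sorted-at-end {m} {acc} {ms} {O} inv = subst (λ w → AllPairs _≤_ (west w))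
  (trans (++-assoc O acc (m ∷ ms)) (cong (_++ acc ++ m ∷ ms) (sym (reverse-involutive O))))
  (west-sorts-decreasing++increasing (O ++ acc) (m ∷ ms)
    (AllPairs.map <⇒≤ (decreasing inv)) (Linked⇒AllPairs ≤-trans (minima↗ inv)))

decreasing-at-end : Invariant m acc ms O → AllPairs _>_ (O ++ factorsFrom m acc [])
decreasing-at-end {m} {acc} {O = O} inv =
  subst (λ w → AllPairs _>_ (O ++ w)) (sym (factorsFrom-[] m acc)) (decreasing inv)

sorts⇔decreasing : ∀ ys → Invariant m acc ms O → Unique ((O ++ acc ++ m ∷ ms) ++ ys) →
  AllPairs _≤_ (west (runStack sigmaCond (acc ++ m ∷ ms) (reverse O) ys))
    ⇔ AllPairs _>_ (O ++ factorsFrom m acc ys)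
sorts⇔decreasing [] inv _ = mk⇔ (λ _ → decreasing-at-end inv) (λ _ → sorted-at-end inv)
sorts⇔decreasing {m} {acc} {ms} {O} (t ∷ ys) inv unique with arrival inv (Unique-++-∷⇒∉ unique)
... | new-minimum t<m =
  subst₂ (λ w v → AllPairs _≤_ (west w) ⇔ AllPairs _>_ v)
    (sym (runStack-σ-new-minimum ys inv t<m))
    (sym (trans (cong (O ++_) (factorsFrom-new-minimum acc ys t<m)) (sym (++-assoc O acc _))))
    (sorts⇔decreasing ys (invariant-new-minimum inv t<m) (Unique-shift (O ++ acc) (m ∷ ms)
      (subst (λ w → Unique (w ++ t ∷ ys)) (sym (++-assoc O acc (m ∷ ms))) unique)))
... | descent-in-factor m<t t<x =
  mk⇔ (⊥-elim ∘ unsorted-descent-in-factor ys inv m<t t<x)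
      (⊥-elim ∘ undecreasing-descent-in-factor ys m<t t<x)
... | exceeds-earlier m<t acc<t o∈O o<t =
  mk⇔ (⊥-elim ∘ unsorted-exceeds-earlier ys inv acc<t o∈O o<t)
      (⊥-elim ∘ undecreasing-exceeds-earlier ys m<t o∈O o<t)
... | extends-factor m<t acc<t t<O =
  subst₂ (λ w v → AllPairs _≤_ (west w) ⇔ AllPairs _>_ v)
    (sym (runStack-via sigmaCond (acc ++ m ∷ ms) (reverse O) t ys (popLoop-σ-extend inv acc<t)))
    (sym (cong (O ++_) (factorsFrom-extend acc ys (<⇒≤ m<t))))
    (sorts⇔decreasing ys (invariant-extend inv m<t acc<t t<O)
      (Unique-shift O (acc ++ m ∷ ms) unique))

idPerm-ascending : ∀ n → AllPairs _<_ (idPerm n)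
idPerm-ascending n = AllPairsₚ.map⁺ (AllPairsₚ.applyUpTo⁺₁ id n (λ i<j _ → s≤s i<j))

mainTheorem5 : (n : ℕ) → 1 ≤ n → (τ : List ℕ) → τ ↭ idPerm n →
    InSort n τ ⇔ Decreasing (revFactors τ)
mainTheorem5 (suc n) _ []       []↭id = ⊥-elim (¬x∷xs↭[] (↭-sym []↭id))
mainTheorem5 n       _ (x ∷ xs) τ↭id  = mk⇔
  (λ west≡id → AllPairs⇒Linked (to (subst (AllPairs _≤_) (sym west≡id) id↗)))
  (λ decr → sorted-↭⇒≡ (from (Linked⇒AllPairs (flip <-trans) decr)) id↗
     (↭-trans (runStack-↭ westCond _) (↭-trans (runStack-↭ sigmaCond (x ∷ xs)) τ↭id)))
  where
  id↗ : AllPairs _≤_ (idPerm n)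
  id↗ = AllPairs.map <⇒≤ (idPerm-ascending n)
  initial : Invariant x [] [] []
  initial = record { decreasing = [] ; acc-above = [] ; out-above = [] ; minima↗ = [-] }
  open Equivalence (sorts⇔decreasing xs initial
    (Unique-resp-↭ (↭-sym τ↭id) (AllPairs.map <⇒≢ (idPerm-ascending n))))
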